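{- Let $n \ge 0$, let $H$ be any graph, and let $G$ be the graph obtained from the disjoint union of the arm graph $A_n$ and $H$ by adding an edge from $b_2^{ -1}\in V(A_n)$ to a vertex $v \in V(H)$. Consider deterministic Zombies and Survivors on $G$ with $m$ zombies $z_1,\dots,z_m$, all on vertices of $H$, and the survivor at vertex $b_0^0$, where $d_i$ denotes the distance in $G$ from the survivor to $z_i$ and $d_1\le d_2\le\cdots\le d_m$. If $$(d_2-d_1)_5 + (d_3-d_2)_5 + \cdots + (d_m - d_{m-1})_5 \le n-1,$$ then the survivor has a winning strategy.
   Context: Deterministic Zombies and Survivors: players alternate turns; the survivor moves to an adjacent vertex or stays still; each zombie must move on every turn to a neighbor strictly closer (in graph distance) to the survivor's current vertex, zombies coordinating among such moves. Zombies win if a zombie occupies the survivor's vertex; the survivor wins by avoiding this forever. For integers $N$ and $r$, $(N)_r$ denotes the remainder of $N$ modulo $r$ (in $\{0,\dots,r-1\}$). For an integer $x$, the graph $T_x$ has vertices $a_i^x, b_i^x$ ($0\le i\le 4$) and $c^x$, with edges: $p_i^x q_j^x$ for all $p,q\in\{a,b\}$ whenever $|i-j|\in\{1,4\}$; $a_i^x b_i^x$ and $a_i^x c^x$ for $0\le i\le 4$. For $n\ge 0$ the arm graph $A_n$ consists of vertices $b_2^{ -1}$ and $b_0^n$ together with disjoint graphs $T_0,\dots,T_{n-1}$, plus edges $b_2^x b_0^{x+1}$ for $-1\le x\le n-1$. -}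

module Defs where

open import Data.Nat using (ℕ; zero; suc; _+_; _≤_; _<_; _<?_; _∸_; _%_; ∣_-_∣)
open import Data.Fin using (Fin; toℕ; fromℕ<) renaming (zero to fzero; suc to fsuc)
open import Data.Vec using (Vec; lookup; []; _∷_)
open import Data.Bool using (Bool; true; false)
open import Data.Sum using (_⊎_)
open import Data.Product using (_×_; _,_; ∃; ∃₂)
open import Data.List using (List; _∷_) renaming ([] to nil)
open import Relation.Nullary using (¬_; yes; no)
open import Relation.Binary.PropositionalEquality using (_≡_)

data Walk {V : Set} (Adj : V → V → Set) : V → V → ℕ → Set where
  here : ∀ {u} → Walk Adj u u 0
  step : ∀ {u w x l} → Adj u w → Walk Adj w x l → Walk Adj u x (suc l)

Dist : {V : Set} → (V → V → Set) → V → V → ℕ → Set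
Dist Adj u w d = Walk Adj u w d × (∀ l → Walk Adj u w l → d ≤ l)

record FinGraph : Set where
  field
    k        : ℕ
    adj      : Fin k → Fin k → Bool
    sym      : ∀ u w → adj u w ≡ adj w u
    loopless : ∀ u → adj u u ≡ false

  Adj : Fin k → Fin k → Set
  Adj u w = adj u w ≡ true

  Connected : Set
  Connected = ∀ u w → ∃ λ l → Walk Adj u w l

-- The graph T_x (vertex set; the index x is carried by the arm)

data AB : Set where
  A B : AB

data TV : Set where
  ab : AB → Fin 5 → TV     -- ab A i = a_i ,  ab B i = b_i
  c  : TV

Cyc : Fin 5 → Fin 5 → Set
Cyc i j = (∣ toℕ i - toℕ j ∣ ≡ 1) ⊎ (∣ toℕ i - toℕ j ∣ ≡ 4)

-- edges of T (listed once; made symmetric below)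
data TE : TV → TV → Set where
  cyc  : ∀ p q i j → Cyc i j → TE (ab p i) (ab q j)
  rung : ∀ i → TE (ab A i) (ab B i)
  hub  : ∀ i → TE (ab A i) c

data ArmV (n : ℕ) : Set where
  bm1 : ArmV n                     -- b_2^{-1}
  bEnd : ArmV n                    -- b_0^n
  t   : Fin n → TV → ArmV n        -- t x u = vertex u of T_x

b0 : ∀ {n} → ℕ → ArmV n
b0 {n} x with x <? n
... | yes p = t (fromℕ< p) (ab B fzero)
... | no _  = bEnd

data ArmE {n : ℕ} : ArmV n → ArmV n → Set where
  inT   : ∀ x {u w} → TE u w → ArmE (t x u) (t x w)
  link₋ : ArmE bm1 (b0 0)
  link  : ∀ x → ArmE (t x (ab B (fsuc (fsuc fzero)))) (b0 (suc (toℕ x)))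

module _ (n : ℕ) (H : FinGraph) (v : Fin (FinGraph.k H)) where
  open FinGraph H

  data GV : Set where
    arm : ArmV n → GV
    hv  : Fin k → GV

  data GE : GV → GV → Set where
    armE : ∀ {u w} → ArmE u w → GE (arm u) (arm w)
    hE   : ∀ {u w} → Adj u w → GE (hv u) (hv w)
    join : GE (arm bm1) (hv v)

  GAdj : GV → GV → Set
  GAdj u w = GE u w ⊎ GE w u

module Game {V : Set} (Adj : V → V → Set) where

  Caught : ∀ {m} → V → Vec V m → Set
  Caught s zs = ∃ λ i → lookup zs i ≡ s

  ZMove : ∀ {m} → V → Vec V m → Vec V m → Set
  ZMove s zs zs' = ∀ i → Adj (lookup zs i) (lookup zs' i)
                        × ∃₂ λ d d' → Dist Adj (lookup zs i) s d
                                    × Dist Adj (lookup zs' i) s d' × d' < d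

  -- A survivor strategy: given the history of previous rounds (pairs of
  -- survivor position and zombie positions at the start of each earlier
  -- round, most recent first) and the current zombie positions (just
  -- after the zombies' move), choose the survivor's next vertex.
  Strategy : ℕ → Set
  Strategy m = List (V × Vec V m) → Vec V m → V

  -- Positions reachable (with the zombies to move) when the survivor
  -- follows σ from survivor position s₀ and zombie positions z₀, together
  -- with the history leading to them.
  data Reach {m} (σ : Strategy m) (s₀ : V) (z₀ : Vec V m) :
             List (V × Vec V m) → V → Vec V m → Set where
    start : Reach σ s₀ z₀ nil s₀ z₀
    round : ∀ {h s zs zs'} → Reach σ s₀ z₀ h s zs → ZMove s zs zs' →
            Reach σ s₀ z₀ ((s , zs) ∷ h) (σ ((s , zs) ∷ h) zs') zs'

  Winning : ∀ {m} → Strategy m → V → Vec V m → Set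
  Winning σ s₀ z₀ = ∀ h s zs → Reach σ s₀ z₀ h s zs →
    ∀ zs' → ZMove s zs zs' →
      ¬ Caught s zs' ×
      (σ ((s , zs) ∷ h) zs' ≡ s ⊎ Adj s (σ ((s , zs) ∷ h) zs')) ×
      ¬ Caught (σ ((s , zs) ∷ h) zs') zs'

  SurvivorWins : ∀ {m} → V → Vec V m → Set
  SurvivorWins {m} s₀ z₀ = ∃ λ (σ : Strategy m) → Winning σ s₀ z₀

gapSum : ∀ {m} → Vec ℕ m → ℕ
gapSum [] = 0
gapSum (x ∷ []) = 0
gapSum (x ∷ y ∷ ys) = (y ∸ x) % 5 + gapSum (y ∷ ys)

-- The survivor ignores the zombies and follows a fixed route. It waits on b₀⁰ for d₁ − 2 rounds, then only
-- walks along the 5-cycles b₀ b₄ b₃ b₂ b₁ of the copies T_x: a loop goes once around T_x, an exit goes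
-- b₀ b₄ b₃ b₂ and on to b₀ of the next copy. A zombie that has not caught up is behind the gate b₂^{x−1} b₀^x,
-- the only edge into the rest of the arm, so it just approaches b₀^x one step per round; a stay or an exit
-- brings it one step closer to the survivor's b₀, a loop five. Making (d_{i+1} − d_i) div 5 loops and
-- (d_{i+1} − d_i) mod 5 exits between consecutive zombies, the i-th zombie reaches b₂^{x−1} exactly when the
-- survivor leaves b₀^x for b₄^x. From then on it trails two steps behind the survivor around the cycle, a
-- finite pattern in three consecutive copies that is checked by evaluation. By the hypothesis on the gap sum
-- the exits never run out of copies.

module Submission where

open import Defs
open import Data.Bool using (Bool; true; false; T; _∧_; _∨_; not)
open import Data.Bool.ListAction using (all; any)
open import Data.Bool.Properties using (T-∧; T-∨; ∨-comm)
open import Data.Empty using (⊥; ⊥-elim)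
open import Data.Fin using (Fin; toℕ; fromℕ<; #_) renaming (zero to fzero; suc to fsuc; _≤_ to _≤ᶠ_)
open import Data.Fin.Properties using (_≟_; toℕ-injective; toℕ<n; toℕ-fromℕ<; fromℕ<-toℕ)
open import Data.List using (List; []; _∷_; _++_; replicate; allFin; cartesianProduct; length)
import Data.List
open import Data.List.Membership.Propositional using (_∈_)
open import Data.List.Membership.Propositional.Properties using (∈-cartesianProduct⁺; ∈-allFin; ∈-++⁺ˡ; ∈-++⁺ʳ; ∈-map⁺)
open import Data.List.Relation.Unary.All using (All; []; _∷_)
import Data.List.Relation.Unary.All as All
open import Data.List.Relation.Unary.All.Properties using (++⁺; replicate⁺; all⁺)
open import Data.List.Relation.Unary.Any using (here; satisfied)
open import Data.List.Relation.Unary.Any.Properties using (any⁻)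
open import Data.Nat using (ℕ; zero; suc; _+_; _*_; _∸_; _/_; _%_; _≤_; _<_; _<?_; z≤n; s≤s; ∣_-_∣)
open import Data.Nat.DivMod using (m≡m%n+[m/n]*n)
open import Data.Nat.Properties using (module ≤-Reasoning; ≤-refl; ≤-trans; ≤-antisym; ≤-pred; <-irrefl; <-trans; ≤-<-trans)
  renaming (_≟_ to _≟ℕ_)
open import Data.Nat.Properties using (+-suc; +-assoc; +-comm; +-mono-≤; +-monoˡ-≤; +-monoʳ-≤; +-cancelʳ-≤; +-cancelʳ-≡)
open import Data.Nat.Properties using (m≤m+n; m≤n+m; n<1+n; n≤1+n; <⇒≱; ≮⇒≥; m≤n⇒m<n∨m≡n; suc-injective)
open import Data.Nat.Properties using (∣n-n∣≡0; *-zeroʳ; *-identityʳ; m∸n+n≡m)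
open import Data.Product using (_×_; _,_; proj₁; proj₂; ∃; ∃₂)
open import Data.Product.Properties using (≡-dec)
open import Data.Sum using (_⊎_; inj₁; inj₂)
open import Data.Unit using (⊤; tt)
open import Data.Vec using (Vec; lookup; []; _∷_; map)
open import Data.Vec.Properties using (lookup-map)
open import Function.Bundles using (Equivalence)
open import Relation.Binary.Definitions using (Symmetric; DecidableEquality)
open import Relation.Binary.PropositionalEquality using (_≡_; _≢_; refl; sym; trans; subst; cong; cong₂; module ≡-Reasoning)
open import Relation.Nullary using (¬_; Dec; yes; no; contradiction)
open import Relation.Nullary.Decidable using (⌊_⌋; toWitness; fromWitness; map′; _×-dec_; _⊎-dec_)
open import Relation.Unary using (Decidable)

module WalkProperties {V : Set} {Adj : V → V → Set} (adj-sym : Symmetric Adj) where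

  infixr 5 _++ʷ_
  infixl 5 _∷ʳ_

  _++ʷ_ : ∀ {u w x l₁ l₂} → Walk Adj u w l₁ → Walk Adj w x l₂ → Walk Adj u x (l₁ + l₂)
  here     ++ʷ q = q
  step a p ++ʷ q = step a (p ++ʷ q)

  _∷ʳ_ : ∀ {u w x l} → Walk Adj u w l → Adj w x → Walk Adj u x (suc l)
  here     ∷ʳ a = step a here
  step b p ∷ʳ a = step b (p ∷ʳ a)

  reverse : ∀ {u w l} → Walk Adj u w l → Walk Adj w u l
  reverse here       = here
  reverse (step a p) = reverse p ∷ʳ adj-sym a

  Dist-sym : ∀ {u w d} → Dist Adj u w d → Dist Adj w u d
  Dist-sym (p , shortest) = reverse p , λ l q → shortest l (reverse q)

  walk₁⇒adj : ∀ {u w} → Walk Adj u w 1 → Adj u w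
  walk₁⇒adj (step a here) = a

  walk-≢⇒nonempty : ∀ {u w l} → u ≢ w → Walk Adj u w l → 1 ≤ l
  walk-≢⇒nonempty u≢w here       = contradiction refl u≢w
  walk-≢⇒nonempty u≢w (step _ _) = s≤s z≤n

  short-walk : ∀ {u w l} → Walk Adj u w l → l ≤ 1 → u ≡ w ⊎ Adj u w
  short-walk here              _             = inj₁ refl
  short-walk (step a here)     _             = inj₂ a
  short-walk (step _ (step _ _)) (s≤s ())

  closer-from-distance-two : ∀ {z z' s d d'} → Walk Adj z s 2 → ¬ Adj z s → Adj z z' →
    Dist Adj z s d → Dist Adj z' s d' → d' < d → z' ≢ s × Adj z' s
  closer-from-distance-two {z} {z'} {s} p ¬zs zz' (_ , shortest) (p' , _) d'<d = z'≢s , z's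
    where
    z'≢s : z' ≢ s
    z'≢s refl = ¬zs zz'
    z's : Adj z' s
    z's with short-walk p' (≤-pred (≤-trans d'<d (shortest 2 p)))
    ... | inj₁ z'≡s = contradiction z'≡s z'≢s
    ... | inj₂ a    = a

  module Gate (Inside : V → Set) (inside? : Decidable Inside) {p b : V} (gate : Adj p b)
              (b-outside : ¬ Inside b)
              (crossing : ∀ {u w} → Adj u w → Inside u → ¬ Inside w → u ≡ p × w ≡ b) where

    split : ∀ {u w l} → Walk Adj u w l → Inside u → ¬ Inside w →
            ∃₂ λ l₁ l₂ → Walk Adj u p l₁ × Walk Adj b w l₂ × l ≡ suc (l₁ + l₂)
    split here u-in w-out = contradiction u-in w-out
    split (step {w = y} a rest) u-in w-out with inside? y
    ... | yes y-in with split rest y-in w-out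
    ...   | l₁ , l₂ , q₁ , q₂ , refl = suc l₁ , l₂ , step a q₁ , q₂ , refl
    split (step a rest) u-in w-out | no y-out with crossing a u-in y-out
    ... | refl , refl = 0 , _ , here , rest , refl

    walk-through-gate : ∀ {u w e L l} → Inside u → ¬ Inside w → Dist Adj u b e →
                        (∀ l → Walk Adj b w l → L ≤ l) → Walk Adj u w l → e + L ≤ l
    walk-through-gate u-in w-out (_ , shortest) L≤ q with split q u-in w-out
    ... | l₁ , l₂ , q₁ , q₂ , refl = +-mono-≤ (shortest (suc l₁) (q₁ ∷ʳ gate)) (L≤ l₂ q₂)

    -- Every walk from inside to s passes through the gate, so inside d(·, s) = d(·, b) + d(b, s):
    -- a step towards s that stays inside brings z exactly one step closer to b.
    step-towards : ∀ {z z' s e L d d'} → Inside z → ¬ Inside s → Dist Adj z b e → Dist Adj b s L →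
                   Adj z z' → Dist Adj z s d → Dist Adj z' s d' → d' < d →
                   (∃ λ e' → e ≡ 2 + e' × Inside z' × Dist Adj z' b (suc e')) ⊎ (e ≡ 1 × z' ≡ b)
    step-towards {z} {z'} {s} {e} {L} {d} {d'} z-in s-out De DL zz' Dz Dz' d'<d with inside? z'
    ... | yes z'-in with split (proj₁ Dz') z'-in s-out
    ...   | l₁ , l₂ , q₁ , q₂ , refl = inj₁ (l₁ , e≡ , z'-in , q₁ ∷ʳ gate , shortest)
      where
      open ≤-Reasoning
      lower : 2 + l₁ ≤ e
      lower = +-cancelʳ-≤ L (2 + l₁) e (begin
        2 + l₁ + L   ≤⟨ +-monoʳ-≤ (2 + l₁) (proj₂ DL l₂ q₂) ⟩
        2 + l₁ + l₂  ≤⟨ d'<d ⟩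
        d            ≤⟨ proj₂ Dz _ (proj₁ De ++ʷ proj₁ DL) ⟩
        e + L        ∎)
      e≡ : e ≡ 2 + l₁
      e≡ = ≤-antisym (proj₂ De _ (step zz' (q₁ ∷ʳ gate))) lower
      shortest : ∀ l → Walk Adj z' b l → suc l₁ ≤ l
      shortest l q = ≤-pred (subst (_≤ suc l) e≡ (proj₂ De (suc l) (step zz' q)))
    step-towards z-in s-out De DL zz' Dz Dz' d'<d | no z'-out with crossing zz' z-in z'-out
    ... | refl , refl =
      inj₂ (≤-antisym (proj₂ De 1 (step gate here)) (walk-≢⇒nonempty p≢b (proj₁ De)) , refl)
      where
      p≢b : p ≢ b
      p≢b p≡b = b-outside (subst Inside p≡b z-in)

T-∨ˡ : ∀ {x y} → T x → T (x ∨ y)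
T-∨ˡ h = Equivalence.from T-∨ (inj₁ h)

T-∨ʳ : ∀ {x y} → T y → T (x ∨ y)
T-∨ʳ h = Equivalence.from T-∨ (inj₂ h)

T-not⇒¬T : ∀ x → T (not x) → ¬ T x
T-not⇒¬T false _ ()

infixr 1 _⇒ᵇ_
_⇒ᵇ_ : Bool → Bool → Bool
a ⇒ᵇ b = not a ∨ b

T-⇒ᵇ : ∀ {a b} → T (a ⇒ᵇ b) → T a → T b
T-⇒ᵇ {true} h _ = h

T-∧⁻ : ∀ {x y} → T (x ∧ y) → T x × T y
T-∧⁻ = Equivalence.to T-∧

b₀ b₁ b₂ b₃ b₄ : TV
b₀ = ab B fzero
b₁ = ab B (fsuc fzero)
b₂ = ab B (fsuc (fsuc fzero))
b₃ = ab B (fsuc (fsuc (fsuc fzero)))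
b₄ = ab B (fsuc (fsuc (fsuc (fsuc fzero))))

_≟ᴬᴮ_ : DecidableEquality AB
A ≟ᴬᴮ A = yes refl
A ≟ᴬᴮ B = no λ ()
B ≟ᴬᴮ A = no λ ()
B ≟ᴬᴮ B = yes refl

_≟ᵀ_ : DecidableEquality TV
ab p i ≟ᵀ ab q j = map′ (λ (p≡q , i≡j) → cong₂ ab p≡q i≡j) (λ { refl → refl , refl }) ((p ≟ᴬᴮ q) ×-dec (i ≟ j))
ab _ _ ≟ᵀ c      = no λ ()
c      ≟ᵀ ab _ _ = no λ ()
c      ≟ᵀ c      = yes refl

cyc? : (i j : Fin 5) → Dec (Cyc i j)
cyc? i j = (∣ toℕ i - toℕ j ∣ ≟ℕ 1) ⊎-dec (∣ toℕ i - toℕ j ∣ ≟ℕ 4)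

rungᵇ : AB → AB → Fin 5 → Fin 5 → Bool
rungᵇ A B i j = ⌊ i ≟ j ⌋
rungᵇ _ _ _ _ = false

edgeᵀ : TV → TV → Bool
edgeᵀ (ab p i) (ab q j) = ⌊ cyc? i j ⌋ ∨ rungᵇ p q i j
edgeᵀ (ab A _) c        = true
edgeᵀ _        _        = false

edgeᵀ-sound : ∀ u w → T (edgeᵀ u w) → TE u w
edgeᵀ-sound (ab p i) (ab q j) h with Equivalence.to T-∨ h
edgeᵀ-sound (ab p i) (ab q j) h | inj₁ ij = cyc p q i j (toWitness {a? = cyc? i j} ij)
edgeᵀ-sound (ab A i) (ab B j) h | inj₂ i≡j with toWitness {a? = i ≟ j} i≡j
... | refl = rung i
edgeᵀ-sound (ab A i) (ab A j) h | inj₂ ()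
edgeᵀ-sound (ab B i) (ab A j) h | inj₂ ()
edgeᵀ-sound (ab B i) (ab B j) h | inj₂ ()
edgeᵀ-sound (ab A i) c        _ = hub i

edgeᵀ-complete : ∀ {u w} → TE u w → T (edgeᵀ u w)
edgeᵀ-complete (cyc p q i j h) = T-∨ˡ (fromWitness {a? = cyc? i j} h)
edgeᵀ-complete (rung i)        = T-∨ʳ (fromWitness {a? = i ≟ i} refl)
edgeᵀ-complete (hub i)         = tt

-- The arm is drawn on the ladder ℕ × TV: b₂^{-1} at height 1, T_x at height x + 2 and b₀^n at height n + 2.
Coord : Set
Coord = ℕ × TV

data CoordEdge : Coord → Coord → Set where
  within : ∀ X {u w} → TE u w → CoordEdge (X , u) (X , w)
  link   : ∀ X → CoordEdge (X , b₂) (suc X , b₀)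

Adjᶜ : Coord → Coord → Set
Adjᶜ x y = CoordEdge x y ⊎ CoordEdge y x

Offset : Set
Offset = Fin 4

pattern o₋₂ = fzero
pattern o₋₁ = fsuc fzero
pattern o₀  = fsuc (fsuc fzero)
pattern o₊₁ = fsuc (fsuc (fsuc fzero))

-- Seen from the survivor's copy T_x, (o , w) is the vertex w of T_{x+o}, o ∈ {−2, −1, 0, +1}.
Local : Set
Local = Offset × TV

frame : ℕ → Local → Coord
frame K (o , w) = toℕ o + K , w

edgeᴸ : Local → Local → Bool
edgeᴸ (o , u) (o' , w) = (⌊ o ≟ o' ⌋ ∧ edgeᵀ u w)
                       ∨ (⌊ toℕ o' ≟ℕ suc (toℕ o) ⌋ ∧ (⌊ u ≟ᵀ b₂ ⌋ ∧ ⌊ w ≟ᵀ b₀ ⌋))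

adjᴸ : Local → Local → Bool
adjᴸ y y' = edgeᴸ y y' ∨ edgeᴸ y' y

-- Offsets all of whose neighbours are again named in the window.
inner : Offset → Bool
inner o₋₁ = true
inner o₀  = true
inner _   = false

edgeᴸ-sound : ∀ K y y' → T (edgeᴸ y y') → CoordEdge (frame K y) (frame K y')
edgeᴸ-sound K (o , u) (o' , w) h with Equivalence.to T-∨ h
... | inj₁ h₁ with Equivalence.to T-∧ h₁
...   | o≡o' , uw with toWitness {a? = o ≟ o'} o≡o'
...     | refl = within _ (edgeᵀ-sound u w uw)
edgeᴸ-sound K (o , u) (o' , w) h | inj₂ h₂ with Equivalence.to T-∧ h₂
... | o'≡1+o , h₃ with Equivalence.to T-∧ h₃
...   | u≡b₂ , w≡b₀
  with toWitness {a? = toℕ o' ≟ℕ suc (toℕ o)} o'≡1+o | toWitness {a? = u ≟ᵀ b₂} u≡b₂ | toWitness {a? = w ≟ᵀ b₀} w≡b₀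
...     | o'≡ | refl | refl rewrite o'≡ = link _

adjᴸ-sound : ∀ K y y' → T (adjᴸ y y') → Adjᶜ (frame K y) (frame K y')
adjᴸ-sound K y y' h with Equivalence.to T-∨ h
... | inj₁ e = inj₁ (edgeᴸ-sound K y y' e)
... | inj₂ e = inj₂ (edgeᴸ-sound K y' y e)

same-copy : ∀ (o : Offset) {b} → T b → T (⌊ o ≟ o ⌋ ∧ b)
same-copy o h = Equivalence.from T-∧ (fromWitness {a? = o ≟ o} refl , h)

adjᴸ-complete : ∀ K o u {X} → T (inner o) → Adjᶜ (frame K (o , u)) X →
                ∃ λ y → X ≡ frame K y × T (adjᴸ (o , u) y)
adjᴸ-complete K o₋₁ _ _ (inj₁ (link _)) = (o₀ , b₀) , refl , tt
adjᴸ-complete K o₀  _ _ (inj₁ (link _)) = (o₊₁ , b₀) , refl , tt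
adjᴸ-complete K o₋₁ _ _ (inj₂ (link _)) = (o₋₂ , b₂) , refl , tt
adjᴸ-complete K o₀  _ _ (inj₂ (link _)) = (o₋₁ , b₂) , refl , tt
adjᴸ-complete K o u _ (inj₁ (within _ {w = w} te)) =
  (o , w) , refl , T-∨ˡ {edgeᴸ (o , u) (o , w)} (T-∨ˡ {⌊ o ≟ o ⌋ ∧ edgeᵀ u w} (same-copy o (edgeᵀ-complete te)))
adjᴸ-complete K o u _ (inj₂ (within _ {u = w} te)) =
  (o , w) , refl , T-∨ʳ {edgeᴸ (o , u) (o , w)} (T-∨ˡ {⌊ o ≟ o ⌋ ∧ edgeᵀ w u} (same-copy o (edgeᵀ-complete te)))

column-of : AB → List TV
column-of p = Data.List.map (ab p) (allFin 5)

tvs : List TV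
tvs = column-of A ++ column-of B ++ c ∷ []

locals : List Local
locals = cartesianProduct (allFin 4) tvs

∈-locals : ∀ y → y ∈ locals
∈-locals (o , w) = ∈-cartesianProduct⁺ (∈-allFin o) (∈-tvs w)
  where
  ∈-tvs : ∀ w → w ∈ tvs
  ∈-tvs (ab A i) = ∈-++⁺ˡ {ys = column-of B ++ c ∷ []} (∈-map⁺ (ab A) (∈-allFin i))
  ∈-tvs (ab B i) = ∈-++⁺ʳ (column-of A) (∈-++⁺ˡ {ys = c ∷ []} (∈-map⁺ (ab B) (∈-allFin i)))
  ∈-tvs c        = ∈-++⁺ʳ (column-of A) (∈-++⁺ʳ (column-of B) (here refl))

-- Positions that exist for every copy x < n (T_{x−1} is just b₂^{-1} when x = 0).
anchored : Local → Bool
anchored (o₀ , _)  = true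
anchored (o₋₁ , w) = ⌊ w ≟ᵀ b₂ ⌋
anchored _         = false

via : Local → Local → Local → Bool
via y s y' = anchored y' ∧ adjᴸ y y' ∧ adjᴸ y' s

twoAway : Local → Local → Bool
twoAway s y = inner (proj₁ y) ∧ not (adjᴸ y s) ∧ any (via y s) locals

adjᴸ-sym : ∀ {y y'} → T (adjᴸ y y') → T (adjᴸ y' y)
adjᴸ-sym {y} {y'} = subst T (∨-comm (edgeᴸ y y') (edgeᴸ y' y))

TE-irreflexive : ∀ {u} → ¬ TE u u
TE-irreflexive (cyc _ _ i _ h) with ∣ toℕ i - toℕ i ∣ | ∣n-n∣≡0 (toℕ i)
TE-irreflexive (cyc _ _ i _ (inj₁ ())) | _ | refl
TE-irreflexive (cyc _ _ i _ (inj₂ ())) | _ | refl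

module Arm (n : ℕ) (H : FinGraph) (v : Fin (FinGraph.k H)) where

  V : Set
  V = GV n H v

  Adj : V → V → Set
  Adj = GAdj n H v

  adj-sym : Symmetric Adj
  adj-sym (inj₁ e) = inj₂ e
  adj-sym (inj₂ e) = inj₁ e

  open WalkProperties {V} {Adj} adj-sym public

  coord : ArmV n → Coord
  coord bm1     = 1 , b₂
  coord bEnd    = 2 + n , b₀
  coord (t x w) = 2 + toℕ x , w

  -- Coordinates that name no vertex of the arm are sent to bEnd or bm1.
  vertexAt : Coord → ArmV n
  vertexAt (zero , _) = bEnd
  vertexAt (suc zero , _) = bm1
  vertexAt (suc (suc x) , w) with x <? n
  ... | yes x<n = t (fromℕ< x<n) w
  ... | no _    = bEnd

  data OnArm : Coord → Set where
    start : OnArm (1 , b₂)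
    body  : ∀ {x} w → x < n → OnArm (2 + x , w)
    end   : OnArm (2 + n , b₀)

  onArm-coord : ∀ a → OnArm (coord a)
  onArm-coord bm1     = start
  onArm-coord bEnd    = end
  onArm-coord (t x w) = body w (toℕ<n x)

  vertexAt-coord : ∀ a → vertexAt (coord a) ≡ a
  vertexAt-coord bm1 = refl
  vertexAt-coord bEnd with n <? n
  ... | yes n<n = contradiction n<n (<-irrefl refl)
  ... | no _    = refl
  vertexAt-coord (t x w) with toℕ x <? n
  ... | yes x<n = cong (λ y → t y w) (fromℕ<-toℕ x x<n)
  ... | no x≮n  = contradiction (toℕ<n x) x≮n

  coord-vertexAt : ∀ {x} → OnArm x → coord (vertexAt x) ≡ x
  coord-vertexAt start = refl
  coord-vertexAt (body {x} w x<n) with x <? n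
  ... | yes x<n′ = cong (λ y → 2 + y , w) (toℕ-fromℕ< x<n′)
  ... | no x≮n   = contradiction x<n x≮n
  coord-vertexAt end with n <? n
  ... | yes n<n = contradiction n<n (<-irrefl refl)
  ... | no _    = refl

  vertexAt-b0 : ∀ x → vertexAt (2 + x , b₀) ≡ b0 x
  vertexAt-b0 x with x <? n
  ... | yes _ = refl
  ... | no _  = refl

  coord-b0 : ∀ {x} → x ≤ n → coord (b0 x) ≡ (2 + x , b₀)
  coord-b0 {x} x≤n with m≤n⇒m<n∨m≡n x≤n
  ... | inj₁ x<n = trans (cong coord (sym (vertexAt-b0 x))) (coord-vertexAt (body b₀ x<n))
  ... | inj₂ refl = trans (cong coord (sym (vertexAt-b0 x))) (coord-vertexAt end)

  armE⇒coordEdge : ∀ {a a'} → ArmE a a' → CoordEdge (coord a) (coord a')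
  armE⇒coordEdge (inT _ te) = within _ te
  armE⇒coordEdge link₋ rewrite coord-b0 {0} z≤n = link 1
  armE⇒coordEdge (link x) rewrite coord-b0 (toℕ<n x) = link (2 + toℕ x)

  coordEdge⇒armE : ∀ {x y} → OnArm x → OnArm y → CoordEdge x y → ArmE (vertexAt x) (vertexAt y)
  coordEdge⇒armE start _ (link _) = subst (ArmE bm1) (sym (vertexAt-b0 0)) link₋
  coordEdge⇒armE (body {x} _ x<n) _ (link _) with x <? n
  ... | yes x<n′ = subst (ArmE (t (fromℕ< x<n′) b₂))
                         (trans (cong (λ y → b0 (suc y)) (toℕ-fromℕ< x<n′)) (sym (vertexAt-b0 (suc x))))
                         (link (fromℕ< x<n′))
  ... | no x≮n   = contradiction x<n x≮n
  coordEdge⇒armE start start (within _ te) = contradiction te TE-irreflexive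
  coordEdge⇒armE end end (within _ te) = contradiction te TE-irreflexive
  coordEdge⇒armE (body {x} _ x<n) (body _ _) (within _ te) with x <? n
  ... | yes x<n′ = inT (fromℕ< x<n′) te
  ... | no x≮n   = contradiction x<n x≮n
  coordEdge⇒armE (body _ n<n) end (within _ _) = contradiction n<n (<-irrefl refl)
  coordEdge⇒armE end (body _ n<n) (within _ _) = contradiction n<n (<-irrefl refl)

  arm-adj⇒Adjᶜ : ∀ {a a'} → Adj (arm a) (arm a') → Adjᶜ (coord a) (coord a')
  arm-adj⇒Adjᶜ (inj₁ (armE e)) = inj₁ (armE⇒coordEdge e)
  arm-adj⇒Adjᶜ (inj₂ (armE e)) = inj₂ (armE⇒coordEdge e)

  Adjᶜ⇒arm-adj : ∀ {x y} → OnArm x → OnArm y → Adjᶜ x y → Adj (arm (vertexAt x)) (arm (vertexAt y))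
  Adjᶜ⇒arm-adj x-on y-on (inj₁ e) = inj₁ (armE (coordEdge⇒armE x-on y-on e))
  Adjᶜ⇒arm-adj x-on y-on (inj₂ e) = inj₂ (armE (coordEdge⇒armE y-on x-on e))

  hv-adj-arm : ∀ {h a} → Adj (hv h) (arm a) → a ≡ bm1
  hv-adj-arm (inj₂ join) = refl

  record Placed (K : ℕ) (y : Local) : Set where
    constructor placed
    field onArm : OnArm (frame K y)

  place : ℕ → Local → V
  place K y = arm (vertexAt (frame K y))

  entry preEntry : ℕ → V
  entry K    = place K (o₀ , b₀)
  preEntry K = place K (o₋₁ , b₂)

  placed₀ : ∀ {K} w → K < n → Placed K (o₀ , w)
  placed₀ w K<n = placed (body w K<n)

  placed₊₁ : ∀ {K} → suc K < n → Placed K (o₊₁ , b₀)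
  placed₊₁ 1+K<n = placed (body b₀ 1+K<n)

  placed-preEntry : ∀ {K} → K < n → Placed K (o₋₁ , b₂)
  placed-preEntry {zero}  _   = placed start
  placed-preEntry {suc K} K<n = placed (body b₂ (<-trans (n<1+n K) K<n))

  frame-injective : ∀ K y y' → frame K y ≡ frame K y' → y ≡ y'
  frame-injective K (o , w) (o' , w') eq with toℕ-injective (+-cancelʳ-≡ K (toℕ o) (toℕ o') (cong proj₁ eq)) | cong proj₂ eq
  ... | refl | refl = refl

  place-injective : ∀ {K y y'} → Placed K y → Placed K y' → place K y ≡ place K y' → y ≡ y'
  place-injective {K} {y} {y'} (placed on) (placed on') eq = frame-injective K y y' (begin
    frame K y                     ≡⟨ coord-vertexAt on ⟨
    coord (vertexAt (frame K y))  ≡⟨ cong coord (arm-injective eq) ⟩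
    coord (vertexAt (frame K y')) ≡⟨ coord-vertexAt on' ⟩
    frame K y'                    ∎)
    where
    open ≡-Reasoning
    arm-injective : ∀ {a a'} → arm {n} {H} {v} a ≡ arm a' → a ≡ a'
    arm-injective refl = refl

  adjᴸ⇒Adj : ∀ {K y y'} → Placed K y → Placed K y' → T (adjᴸ y y') → Adj (place K y) (place K y')
  adjᴸ⇒Adj {K} {y} {y'} (placed on) (placed on') h = Adjᶜ⇒arm-adj on on' (adjᴸ-sound K y y' h)

  inner-neighbour : ∀ {K o u a} → T (inner o) → Placed K (o , u) → Adj (place K (o , u)) (arm a) →
                    ∃ λ y → Placed K y × arm a ≡ place K y × T (adjᴸ (o , u) y)
  inner-neighbour {K} {o} {u} {a} inner-o (placed on) adj
    with adjᴸ-complete K o u inner-o (subst (λ x → Adjᶜ x (coord a)) (coord-vertexAt on) (arm-adj⇒Adjᶜ adj))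
  ... | y , coord-a≡ , h =
    y , placed (subst OnArm coord-a≡ (onArm-coord a)) , cong arm (trans (sym (vertexAt-coord a)) (cong vertexAt coord-a≡)) , h

  rank : V → ℕ
  rank (hv _)  = 0
  rank (arm a) = proj₁ (coord a)

  record Behind (K : ℕ) (z : V) : Set where
    constructor behind
    field rank< : rank z < 2 + K

  behind? : ∀ K → Decidable (Behind K)
  behind? K z = map′ behind Behind.rank< (rank z <? 2 + K)

  behind-suc : ∀ {K z} → Behind K z → Behind (suc K) z
  behind-suc (behind z-in) = behind (<-trans z-in (n<1+n _))

  rank-place : ∀ {K y} → Placed K y → rank (place K y) ≡ toℕ (proj₁ y) + K
  rank-place (placed on) = cong proj₁ (coord-vertexAt on)

  not-behind : ∀ {K o w} → Placed K (o , w) → 2 ≤ toℕ o → ¬ Behind K (place K (o , w))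
  not-behind {K} {o} {w} on 2≤o (behind z-in) = <⇒≱ (subst (_< 2 + K) (rank-place on) z-in) (+-monoˡ-≤ K 2≤o)

  entry-behind-suc : ∀ {K} → K < n → Behind (suc K) (entry K)
  entry-behind-suc {K} K<n = behind (subst (_< 3 + K) (sym (rank-place (placed₀ b₀ K<n))) (n<1+n _))

  ladder-crossing : ∀ K {x y} → Adjᶜ x y → proj₁ x < 2 + K → ¬ proj₁ y < 2 + K →
                    x ≡ (1 + K , b₂) × y ≡ (2 + K , b₀)
  ladder-crossing K (inj₁ (within _ _)) x-in y-out = contradiction x-in y-out
  ladder-crossing K (inj₂ (within _ _)) x-in y-out = contradiction x-in y-out
  ladder-crossing K (inj₁ (link X)) x-in y-out with ≤-antisym (≤-pred x-in) (≤-pred (≮⇒≥ y-out))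
  ... | refl = refl , refl
  ladder-crossing K (inj₂ (link X)) x-in y-out = contradiction (<-trans (n<1+n X) x-in) y-out

  crossing : ∀ K {z y} → Adj z y → Behind K z → ¬ Behind K y → z ≡ preEntry K × y ≡ entry K
  crossing K {hv _}  {hv _}   _   _    y-out = contradiction (behind (s≤s z≤n)) y-out
  crossing K {arm _} {hv _}   _   _    y-out = contradiction (behind (s≤s z≤n)) y-out
  crossing K {hv _}  {arm _}  adj _    y-out with hv-adj-arm adj
  ... | refl = contradiction (behind (s≤s (s≤s z≤n))) y-out
  crossing K {arm a} {arm a'} adj (behind z-in) y-out
    with ladder-crossing K (arm-adj⇒Adjᶜ adj) z-in (λ y-in → y-out (behind y-in))
  ... | a≡ , a'≡ = cong arm (trans (sym (vertexAt-coord a)) (cong vertexAt a≡)) ,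
                   cong arm (trans (sym (vertexAt-coord a')) (cong vertexAt a'≡))

  gate : ∀ {K} → K < n → Adj (preEntry K) (entry K)
  gate {K} K<n = adjᴸ⇒Adj (placed-preEntry K<n) (placed₀ b₀ K<n) tt

  module GateAt {K} (K<n : K < n) =
    Gate (Behind K) (behind? K) (gate K<n) (not-behind (placed₀ b₀ K<n) ≤-refl) (crossing K)

  behind-≢ : ∀ {K z s} → Behind K z → ¬ Behind K s → z ≢ s
  behind-≢ z-in s-out refl = s-out z-in

  local-≢ : ∀ {K y y'} → Placed K y → Placed K y' → y ≢ y' → place K y ≢ place K y'
  local-≢ on on' y≢y' eq = y≢y' (place-injective on on' eq)

  caught-up : ∀ {K z'} → K < n → Behind K z' → Dist Adj z' (entry K) 1 → z' ≡ preEntry K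
  caught-up K<n z'-in Dz' = proj₁ (crossing _ (walk₁⇒adj (proj₁ Dz')) z'-in (not-behind (placed₀ b₀ K<n) ≤-refl))

  local-distinct : ∀ {K y y' l} → Placed K y → Placed K y' → y ≢ y' → Walk Adj (place K y) (place K y') l → 1 ≤ l
  local-distinct on on' y≢y' = walk-≢⇒nonempty (local-≢ on on' y≢y')

  local-apart : ∀ {K o u y' l} → T (inner o) → Placed K (o , u) → Placed K y' → (o , u) ≢ y' →
                T (not (adjᴸ (o , u) y')) → Walk Adj (place K (o , u)) (place K y') l → 2 ≤ l
  local-apart {l = zero} _ on on' y≢y' _ p = contradiction (local-distinct on on' y≢y' p) λ ()
  local-apart {K} {o} {u} {y'} {suc zero} inner-o on on' _ ¬adj p with inner-neighbour inner-o on (walk₁⇒adj p)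
  ... | y'' , on'' , eq , adj =
    contradiction (subst (λ y → T (adjᴸ (o , u) y)) (sym (place-injective on' on'' eq)) adj) (T-not⇒¬T _ ¬adj)
  local-apart {l = suc (suc _)} _ _ _ _ _ _ = s≤s (s≤s z≤n)

  entry-to-next : ∀ {K} → suc K < n → Walk Adj (entry K) (entry (suc K)) 3
  entry-to-next {K} 1+K<n =
    step (adjᴸ⇒Adj (at b₀) (at b₁) tt)
      (step (adjᴸ⇒Adj (at b₁) (at b₂) tt)
        (step (adjᴸ⇒Adj (at b₂) (placed₊₁ 1+K<n) tt) here))
    where
    at : ∀ w → Placed K (o₀ , w)
    at w = placed₀ w (<-trans (n<1+n K) 1+K<n)

  entry-apart-b₂ : ∀ {K l} → K < n → Walk Adj (entry K) (place K (o₀ , b₂)) l → 2 ≤ l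
  entry-apart-b₂ K<n = local-apart tt (placed₀ b₀ K<n) (placed₀ b₂ K<n) (λ ()) tt

  walk-to-b₂ : ∀ {K z e l} → K < n → Behind K z ⊎ z ≡ entry K → Dist Adj z (entry K) e →
               Walk Adj z (place K (o₀ , b₂)) l → e + 2 ≤ l
  walk-to-b₂ K<n (inj₁ z-in) De q =
    GateAt.walk-through-gate K<n z-in (not-behind (placed₀ b₂ K<n) ≤-refl) De (λ _ → entry-apart-b₂ K<n) q
  walk-to-b₂ K<n (inj₂ refl) (_ , shortest) q with shortest 0 here
  ... | z≤n = entry-apart-b₂ K<n q

  behind-suc-or-entry : ∀ {K z} → K < n → Behind K z ⊎ z ≡ entry K → Behind (suc K) z
  behind-suc-or-entry _   (inj₁ z-in) = behind-suc z-in
  behind-suc-or-entry K<n (inj₂ refl) = entry-behind-suc K<n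

  entry-distance-suc : ∀ {K z e} → suc K < n → Behind K z ⊎ z ≡ entry K → Dist Adj z (entry K) e →
                       Dist Adj z (entry (suc K)) (e + 3) × Behind (suc K) z
  entry-distance-suc {K} {z} {e} 1+K<n z-at De = (proj₁ De ++ʷ entry-to-next 1+K<n , shortest) , z-in
    where
    K<n : K < n
    K<n = <-trans (n<1+n K) 1+K<n
    z-in : Behind (suc K) z
    z-in = behind-suc-or-entry K<n z-at
    shortest : ∀ l → Walk Adj z (entry (suc K)) l → e + 3 ≤ l
    shortest l q with GateAt.split 1+K<n q z-in (not-behind (placed₀ b₀ 1+K<n) ≤-refl)
    ... | l₁ , l₂ , q₁ , _ , refl =
      subst (_≤ suc (l₁ + l₂)) (sym (+-suc e 2)) (s≤s (≤-trans (walk-to-b₂ K<n z-at De q₁) (m≤m+n l₁ l₂)))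

  entry-to-corner : ∀ {K} → K < n → ∀ j → ∃ λ L → Dist Adj (entry K) (place K (o₀ , ab B j)) L
  entry-to-corner {K} K<n = distance
    where
    at : ∀ w → Placed K (o₀ , w)
    at w = placed₀ w K<n
    distance : ∀ j → ∃ λ L → Dist Adj (entry K) (place K (o₀ , ab B j)) L
    distance fzero = 0 , here , λ _ _ → z≤n
    distance (fsuc fzero) =
      1 , step (adjᴸ⇒Adj (at b₀) (at b₁) tt) here , λ _ → local-distinct (at b₀) (at b₁) λ ()
    distance (fsuc (fsuc fzero)) =
      2 , step (adjᴸ⇒Adj (at b₀) (at b₁) tt) (step (adjᴸ⇒Adj (at b₁) (at b₂) tt) here) ,
      λ _ → local-apart tt (at b₀) (at b₂) (λ ()) tt
    distance (fsuc (fsuc (fsuc fzero))) =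
      2 , step (adjᴸ⇒Adj (at b₀) (at b₄) tt) (step (adjᴸ⇒Adj (at b₄) (at b₃) tt) here) ,
      λ _ → local-apart tt (at b₀) (at b₃) (λ ()) tt
    distance (fsuc (fsuc (fsuc (fsuc fzero)))) =
      1 , step (adjᴸ⇒Adj (at b₀) (at b₄) tt) here , λ _ → local-distinct (at b₀) (at b₄) λ ()

  anchored-placed : ∀ {K} → K < n → ∀ y → T (anchored y) → Placed K y
  anchored-placed K<n (o₀ , w) _ = placed₀ w K<n
  anchored-placed K<n (o₋₁ , w) h with toWitness {a? = w ≟ᵀ b₂} h
  ... | refl = placed-preEntry K<n

  ¬hv-adj-current : ∀ {K w h} → Placed K (o₀ , w) → ¬ Adj (hv h) (place K (o₀ , w))
  ¬hv-adj-current (placed on) adj with trans (sym (coord-vertexAt on)) (cong coord (hv-adj-arm adj))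
  ... | ()

  current-neighbour : ∀ {K w z} → Placed K (o₀ , w) → Adj z (place K (o₀ , w)) →
                      ∃ λ y → Placed K y × z ≡ place K y × T (adjᴸ y (o₀ , w))
  current-neighbour {z = hv _} on adj = contradiction adj (¬hv-adj-current on)
  current-neighbour {z = arm _} on adj with inner-neighbour tt on (adj-sym adj)
  ... | y , on-y , eq , h = y , on-y , eq , adjᴸ-sym {o₀ , _} {y} h

  twoAway-sound : ∀ {K w o u} → K < n → Placed K (o , u) → T (twoAway (o₀ , w) (o , u)) →
                  T (inner o) × ¬ Adj (place K (o , u)) (place K (o₀ , w)) × Walk Adj (place K (o , u)) (place K (o₀ , w)) 2
  twoAway-sound {K} {w} {o} {u} K<n on h
    with T-∧⁻ {inner o} {not (adjᴸ (o , u) (o₀ , w)) ∧ any (via (o , u) (o₀ , w)) locals} h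
  ... | inner-o , h₁ with T-∧⁻ {not (adjᴸ (o , u) (o₀ , w))} {any (via (o , u) (o₀ , w)) locals} h₁
  ... | ¬adjᴸ , some with satisfied (any⁻ (via (o , u) (o₀ , w)) locals some)
  ... | ym , ym-ok with T-∧⁻ {anchored ym} {adjᴸ (o , u) ym ∧ adjᴸ ym (o₀ , w)} ym-ok
  ... | anchored-ym , path with T-∧⁻ {adjᴸ (o , u) ym} {adjᴸ ym (o₀ , w)} path
  ... | y-ym , ym-s = inner-o , ¬adj , step (adjᴸ⇒Adj on ym-on y-ym) (step (adjᴸ⇒Adj ym-on s-on ym-s) here)
    where
    s-on : Placed K (o₀ , w)
    s-on = placed₀ w K<n
    ym-on : Placed K ym
    ym-on = anchored-placed K<n ym anchored-ym
    ¬adj : ¬ Adj (place K (o , u)) (place K (o₀ , w))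
    ¬adj a with inner-neighbour inner-o on a
    ... | y' , on' , eq , h′ =
      T-not⇒¬T _ ¬adjᴸ (subst (λ y → T (adjᴸ (o , u) y)) (sym (place-injective s-on on' eq)) h′)

  two-away-step : ∀ {K w o u z' d d'} → K < n → Placed K (o , u) → T (twoAway (o₀ , w) (o , u)) →
                  Adj (place K (o , u)) z' → Dist Adj (place K (o , u)) (place K (o₀ , w)) d →
                  Dist Adj z' (place K (o₀ , w)) d' → d' < d →
                  z' ≢ place K (o₀ , w) × ∃ λ y → Placed K y × z' ≡ place K y × T (adjᴸ (o , u) y ∧ adjᴸ y (o₀ , w))
  two-away-step {K} {w} {o} {u} K<n on two adj Dz Dz' d'<d =
    let inner-o , ¬adj , walk₂      = twoAway-sound K<n on two
        z'≢s , z's                 = closer-from-distance-two walk₂ ¬adj adj Dz Dz' d'<d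
        y , on-y , z'≡y , y-s      = current-neighbour (placed₀ w K<n) z's
        y' , on-y' , y≡y' , u-y'   = inner-neighbour inner-o on (subst (Adj (place K (o , u))) z'≡y adj)
    in z'≢s , y , on-y , z'≡y ,
       Equivalence.from T-∧ (subst (λ q → T (adjᴸ (o , u) q)) (sym (place-injective on-y on-y' y≡y')) u-y' , y-s)

  entry₀-far-from-H : ∀ {h l} → 0 < n → Walk Adj (hv h) (entry 0) l → 2 ≤ l
  entry₀-far-from-H 0<n q with GateAt.split 0<n q (behind (s≤s z≤n)) (not-behind (placed₀ b₀ 0<n) ≤-refl)
  ... | l₁ , l₂ , q₁ , _ , refl = s≤s (≤-trans (walk-≢⇒nonempty (λ ()) q₁) (m≤m+n l₁ l₂))

data Move : Set where
  loop exit : Move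

data Seg : Set where
  stay : Seg
  run  : Move → Seg

-- How much closer to the survivor's b₀ a zombie behind the gate gets: an exit takes four rounds but
-- moves that b₀ three steps further away.
duration : Seg → ℕ
duration stay       = 1
duration (run loop) = 5
duration (run exit) = 1

Moving : Seg → Set
Moving stay    = ⊥
Moving (run _) = ⊤

exitCount : Seg → ℕ
exitCount (run exit) = 1
exitCount _          = 0

exits : List Seg → ℕ
exits []      = 0
exits (s ∷ p) = exitCount s + exits p

-- Once its plan is used up, the survivor keeps looping.
headSeg : List Seg → Seg
headSeg []      = run loop
headSeg (s ∷ _) = s

tailSeg : List Seg → List Seg
tailSeg []      = []
tailSeg (_ ∷ p) = p

data StaysFirst : List Seg → Set where
  no-stays : ∀ {p} → All Moving p → StaysFirst p
  stay∷_ : ∀ {p} → StaysFirst p → StaysFirst (stay ∷ p)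

data Phase : Set where
  at₀         : Seg → Phase
  at₄ at₃ at₂ : Move → Phase
  at₁         : Phase

current : Phase → Seg
current (at₀ s) = s
current (at₄ m) = run m
current (at₃ m) = run m
current (at₂ m) = run m
current at₁     = run loop

cornerIndex : Phase → Fin 5
cornerIndex (at₀ _) = # 0
cornerIndex (at₄ _) = # 4
cornerIndex (at₃ _) = # 3
cornerIndex (at₂ _) = # 2
cornerIndex at₁     = # 1

corner : Phase → TV
corner ph = ab B (cornerIndex ph)

elapsed : Phase → ℕ
elapsed (at₀ _) = 0
elapsed (at₄ _) = 1
elapsed (at₃ _) = 2
elapsed (at₂ _) = 3
elapsed at₁     = 4

-- The survivor stands on corner phase of T_level, in a segment begun at clock; plan lists the segments after it.
record State : Set where
  constructor ⟨_,_,_,_⟩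
  field
    level : ℕ
    clock : ℕ
    phase : Phase
    plan  : List Seg

open State

visit : ℕ → ℕ → List Seg → State
visit x ς p = ⟨ x , ς , at₀ (headSeg p) , tailSeg p ⟩

next : State → State
next ⟨ x , ς , at₀ stay    , p ⟩ = visit x (suc ς) p
next ⟨ x , ς , at₀ (run m) , p ⟩ = ⟨ x , ς , at₄ m , p ⟩
next ⟨ x , ς , at₄ m       , p ⟩ = ⟨ x , ς , at₃ m , p ⟩
next ⟨ x , ς , at₃ m       , p ⟩ = ⟨ x , ς , at₂ m , p ⟩
next ⟨ x , ς , at₂ loop    , p ⟩ = ⟨ x , ς , at₁ , p ⟩
next ⟨ x , ς , at₂ exit    , p ⟩ = visit (suc x) (suc ς) p
next ⟨ x , ς , at₁         , p ⟩ = visit x (5 + ς) p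

route : State → ℕ → State
route st zero    = st
route st (suc k) = next (route st k)

pending : State → List Seg
pending st = current (phase st) ∷ plan st

now : State → ℕ
now st = elapsed (phase st) + clock st

data Meets : ℕ → Seg → List Seg → ℕ → Set where
  starts : ∀ {ς s p} → Moving s → Meets ς s p ς
  skips  : ∀ {ς s p τ} → Meets (duration s + ς) (headSeg p) (tailSeg p) τ → Meets ς s p τ

PlanMeets : ℕ → List Seg → ℕ → Set
PlanMeets ς p τ = Meets ς (headSeg p) (tailSeg p) τ

Upcoming : State → ℕ → Set
Upcoming ⟨ _ , ς , at₀ s , p ⟩ τ = Meets ς s p τ
Upcoming ⟨ _ , ς , ph    , p ⟩ τ = PlanMeets (duration (current ph) + ς) p τ

meets-≤ : ∀ {ς s p τ} → Meets ς s p τ → ς ≤ τ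
meets-≤ (starts _) = ≤-refl
meets-≤ (skips {s = s} r) = ≤-trans (m≤n+m _ (duration s)) (meets-≤ r)

meets-replicate : ∀ k s {ς q τ} → PlanMeets (k * duration s + ς) q τ → PlanMeets ς (replicate k s ++ q) τ
meets-replicate zero    s r = r
meets-replicate (suc k) s {ς} {q} {τ} r =
  skips (meets-replicate k s (subst (λ c → PlanMeets c q τ) reassociate r))
  where
  reassociate : duration s + k * duration s + ς ≡ k * duration s + (duration s + ς)
  reassociate = trans (cong (_+ ς) (+-comm (duration s) (k * duration s))) (+-assoc (k * duration s) (duration s) ς)

head-moving : ∀ {p} → All Moving p → Moving (headSeg p)
head-moving []      = tt
head-moving (h ∷ _) = h

all-uncons : ∀ {p} → All Moving p → All Moving (headSeg p ∷ tailSeg p)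
all-uncons []         = tt ∷ []
all-uncons (h ∷ hs)   = h ∷ hs

staysFirst-uncons : ∀ {p} → StaysFirst p → StaysFirst (headSeg p ∷ tailSeg p)
staysFirst-uncons {[]}    _  = no-stays (tt ∷ [])
staysFirst-uncons {_ ∷ _} sp = sp

staysFirst-run : ∀ {m p} → StaysFirst (run m ∷ p) → All Moving p
staysFirst-run (no-stays (_ ∷ hs)) = hs

staysFirst-stay : ∀ {p} → StaysFirst (stay ∷ p) → StaysFirst p
staysFirst-stay (no-stays (() ∷ _))
staysFirst-stay (stay∷ sp) = sp

exits-uncons : ∀ p → exits (headSeg p ∷ tailSeg p) ≡ exits p
exits-uncons []      = refl
exits-uncons (_ ∷ _) = refl

gaps : ∀ {m} → ℕ → Vec ℕ m → List Seg
gaps a []       = []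
gaps a (b ∷ ds) = replicate ((b ∸ a) / 5) (run loop) ++ replicate ((b ∸ a) % 5) (run exit) ++ gaps b ds

survivorPlan : ∀ {m} → Vec ℕ m → List Seg
survivorPlan []       = []
survivorPlan (d ∷ ds) = replicate (d ∸ 2) stay ++ gaps d ds

exits-replicate : ∀ k s q → exits (replicate k s ++ q) ≡ k * exitCount s + exits q
exits-replicate zero    s q = refl
exits-replicate (suc k) s q =
  trans (cong (exitCount s +_) (exits-replicate k s q)) (sym (+-assoc (exitCount s) (k * exitCount s) (exits q)))

exits-gaps : ∀ {m} a (ds : Vec ℕ m) → exits (gaps a ds) ≡ gapSum (a ∷ ds)
exits-gaps a []       = refl
exits-gaps a (b ∷ ds) = begin
  exits (replicate q (run loop) ++ replicate r (run exit) ++ gaps b ds) ≡⟨ exits-replicate q (run loop) _ ⟩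
  q * 0 + exits (replicate r (run exit) ++ gaps b ds)                  ≡⟨ cong₂ _+_ (*-zeroʳ q) (exits-replicate r (run exit) _) ⟩
  r * 1 + exits (gaps b ds)                                            ≡⟨ cong₂ _+_ (*-identityʳ r) (exits-gaps b ds) ⟩
  r + gapSum (b ∷ ds)                                                  ∎
  where
  open ≡-Reasoning
  q r : ℕ
  q = (b ∸ a) / 5
  r = (b ∸ a) % 5

exits-survivorPlan : ∀ {m} (ds : Vec ℕ m) → exits (survivorPlan ds) ≡ gapSum ds
exits-survivorPlan []       = refl
exits-survivorPlan (d ∷ ds) = trans (exits-replicate (d ∸ 2) stay _) (cong₂ _+_ (*-zeroʳ (d ∸ 2)) (exits-gaps d ds))

moving-gaps : ∀ {m} a (ds : Vec ℕ m) → All Moving (gaps a ds)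
moving-gaps a []       = []
moving-gaps a (b ∷ ds) = ++⁺ (replicate⁺ ((b ∸ a) / 5) tt) (++⁺ (replicate⁺ ((b ∸ a) % 5) tt) (moving-gaps b ds))

staysFirst-stays : ∀ k {q} → StaysFirst q → StaysFirst (replicate k stay ++ q)
staysFirst-stays zero    sq = sq
staysFirst-stays (suc k) sq = stay∷ staysFirst-stays k sq

staysFirst-plan : ∀ {m} (ds : Vec ℕ m) → StaysFirst (survivorPlan ds)
staysFirst-plan []       = no-stays []
staysFirst-plan (d ∷ ds) = staysFirst-stays (d ∸ 2) (no-stays (moving-gaps d ds))

Sorted : ∀ {m} → Vec ℕ m → Set
Sorted ds = ∀ i j → i ≤ᶠ j → lookup ds i ≤ lookup ds j

-- Each gap b − a is covered by ⌊(b − a)/5⌋ loops and (b − a) mod 5 exits, advancing the clock from a to b.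
meets-gaps : ∀ {m} a (ds : Vec ℕ m) → Sorted (a ∷ ds) → ∀ i → PlanMeets a (gaps a ds) (lookup (a ∷ ds) i)
meets-gaps a ds _ fzero = starts (head-moving (moving-gaps a ds))
meets-gaps a (b ∷ ds) sorted (fsuc i) =
  meets-replicate q (run loop) (meets-replicate r (run exit)
    (subst (λ c → PlanMeets c (gaps b ds) (lookup (b ∷ ds) i)) (sym clock-b)
      (meets-gaps b ds (λ i j i≤j → sorted (fsuc i) (fsuc j) (s≤s i≤j)) i)))
  where
  open ≡-Reasoning
  q r : ℕ
  q = (b ∸ a) / 5
  r = (b ∸ a) % 5
  clock-b : r * 1 + (q * 5 + a) ≡ b
  clock-b = begin
    r * 1 + (q * 5 + a) ≡⟨ cong (_+ (q * 5 + a)) (*-identityʳ r) ⟩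
    r + (q * 5 + a)     ≡⟨ +-assoc r (q * 5) a ⟨
    r + q * 5 + a       ≡⟨ cong (_+ a) (m≡m%n+[m/n]*n (b ∸ a) 5) ⟨
    b ∸ a + a           ≡⟨ m∸n+n≡m (sorted fzero (fsuc fzero) z≤n) ⟩
    b                   ∎

meets-survivorPlan : ∀ {m} (ds : Vec ℕ m) → Sorted ds → (∀ i → 2 ≤ lookup ds i) →
                   ∀ i → PlanMeets 2 (survivorPlan ds) (lookup ds i)
meets-survivorPlan (d ∷ ds) sorted 2≤ i =
  meets-replicate (d ∸ 2) stay
    (subst (λ c → PlanMeets c (gaps d ds) (lookup (d ∷ ds) i)) (sym clock-d) (meets-gaps d ds sorted i))
  where
  clock-d : (d ∸ 2) * 1 + 2 ≡ d
  clock-d = trans (cong (_+ 2) (*-identityʳ (d ∸ 2))) (m∸n+n≡m (2≤ fzero))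

_==ᴸ_ : Local → Local → Bool
y ==ᴸ y' = ⌊ ≡-dec _≟_ _≟ᵀ_ y y' ⌋

column : Fin 5 → TV → Bool
column j (ab _ i) = ⌊ i ≟ j ⌋
column j c        = false

on : Offset → Fin 5 → Local → Bool
on o j (o' , w) = ⌊ o ≟ o' ⌋ ∧ column j w

-- Where a zombie that has caught up can be: two steps behind the survivor on the cycle.
tight : Phase → Local → Bool
tight (at₀ stay)    _ = false
tight (at₀ (run _)) y = on o₀ (# 2) y ∨ on o₋₁ (# 3) y ∨ on o₋₁ (# 1) y
tight (at₄ _)       y = on o₀ (# 1) y ∨ y ==ᴸ (o₋₁ , b₂)
tight (at₃ _)       y = on o₀ (# 0) y
tight (at₂ loop)    y = on o₀ (# 4) y
tight (at₂ exit)    y = on o₀ (# 4) y ∨ y ==ᴸ (o₀ , b₀)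
tight at₁           y = on o₀ (# 3) y

-- The name of a position in the frame one level up (o₋₂ has none and is kept).
lower : Local → Local
lower (o₋₂ , w) = o₋₂ , w
lower (o₋₁ , w) = o₋₂ , w
lower (o₀  , w) = o₋₁ , w
lower (o₊₁ , w) = o₀  , w

survivorAfter : Phase → Local
survivorAfter (at₀ stay)    = o₀ , b₀
survivorAfter (at₀ (run _)) = o₀ , b₄
survivorAfter (at₄ _)       = o₀ , b₃
survivorAfter (at₃ _)       = o₀ , b₂
survivorAfter (at₂ loop)    = o₀ , b₁
survivorAfter (at₂ exit)    = o₊₁ , b₀
survivorAfter at₁           = o₀ , b₀

tightAfter : Phase → Local → Bool
tightAfter (at₀ stay)    _ = false
tightAfter (at₀ (run m)) y = tight (at₄ m) y
tightAfter (at₄ m)       y = tight (at₃ m) y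
tightAfter (at₃ m)       y = tight (at₂ m) y
tightAfter (at₂ loop)    y = tight at₁ y
tightAfter (at₂ exit)    y = tight (at₀ (run loop)) (lower y)
tightAfter at₁           y = tight (at₀ (run loop)) y

tightStepOk : Phase → Local → Local → Bool
tightStepOk ph y y' =
  tight ph y ⇒ᵇ twoAway s y ∧ (adjᴸ y y' ∧ adjᴸ y' s ⇒ᵇ not (y' ==ᴸ survivorAfter ph) ∧ tightAfter ph y')
  where
  s : Local
  s = o₀ , corner ph

tightStable : Phase → Bool
tightStable ph = all (λ y → all (tightStepOk ph y) locals) locals

tightStable-all : ∀ ph → T (tightStable ph)
tightStable-all (at₀ stay)    = tt
tightStable-all (at₀ (run loop)) = tt
tightStable-all (at₀ (run exit)) = tt
tightStable-all (at₄ loop)    = tt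
tightStable-all (at₄ exit)    = tt
tightStable-all (at₃ loop)    = tt
tightStable-all (at₃ exit)    = tt
tightStable-all (at₂ loop)    = tt
tightStable-all (at₂ exit)    = tt
tightStable-all at₁           = tt

tightStepOk-holds : ∀ ph y y' → T (tightStepOk ph y y')
tightStepOk-holds ph y y' = All.lookup (all⁺ (tightStepOk ph y) locals (row y)) (∈-locals y')
  where
  row : ∀ y → T (all (tightStepOk ph y) locals)
  row y = All.lookup (all⁺ (λ y → all (tightStepOk ph y) locals) locals (tightStable-all ph)) (∈-locals y)

tight-at₀ : ∀ {s y} → Moving s → T (tight (at₀ (run loop)) y) → T (tight (at₀ s) y)
tight-at₀ {stay}  ()
tight-at₀ {run _} _ h = h

module Survival (n : ℕ) (H : FinGraph) (v : Fin (FinGraph.k H)) where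

  open Arm n H v public

  position : State → V
  position st = place (level st) (o₀ , corner (phase st))

  record Feasible (st : State) : Set where
    constructor feasible
    field
      room   : level st + exits (pending st) < n
      ordered : StaysFirst (pending st)

  feasible-level : ∀ {st} → Feasible st → level st < n
  feasible-level (feasible room _) = ≤-<-trans (m≤m+n _ _) room

  feasible-exit : ∀ {x ς p} → Feasible ⟨ x , ς , at₂ exit , p ⟩ → suc x < n
  feasible-exit {x} {_} {p} (feasible room _) = ≤-<-trans (s≤s (m≤m+n x (exits p))) (subst (_< n) (+-suc x (exits p)) room)

  feasible-next : ∀ st → Feasible st → Feasible (next st)
  feasible-next ⟨ x , ς , at₀ stay , p ⟩ (feasible room ordered) =
    feasible (subst (λ e → x + e < n) (sym (exits-uncons p)) room) (staysFirst-uncons (staysFirst-stay ordered))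
  feasible-next ⟨ x , ς , at₀ (run _) , p ⟩ (feasible room ordered) = feasible room ordered
  feasible-next ⟨ x , ς , at₄ _ , p ⟩       (feasible room ordered) = feasible room ordered
  feasible-next ⟨ x , ς , at₃ _ , p ⟩       (feasible room ordered) = feasible room ordered
  feasible-next ⟨ x , ς , at₂ loop , p ⟩    (feasible room ordered) = feasible room ordered
  feasible-next ⟨ x , ς , at₂ exit , p ⟩ (feasible room ordered) =
    feasible (subst (_< n) (trans (+-suc x (exits p)) (cong (λ e → suc (x + e)) (sym (exits-uncons p)))) room)
             (no-stays (all-uncons (staysFirst-run ordered)))
  feasible-next ⟨ x , ς , at₁ , p ⟩ (feasible room ordered) =
    feasible (subst (λ e → x + e < n) (sym (exits-uncons p)) room) (no-stays (all-uncons (staysFirst-run ordered)))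

  position-next : ∀ st → position (next st) ≡ place (level st) (survivorAfter (phase st))
  position-next ⟨ x , ς , at₀ stay , p ⟩    = refl
  position-next ⟨ x , ς , at₀ (run _) , p ⟩ = refl
  position-next ⟨ x , ς , at₄ _ , p ⟩       = refl
  position-next ⟨ x , ς , at₃ _ , p ⟩       = refl
  position-next ⟨ x , ς , at₂ loop , p ⟩    = refl
  position-next ⟨ x , ς , at₂ exit , p ⟩    = refl
  position-next ⟨ x , ς , at₁ , p ⟩         = refl

  placed-after : ∀ st → Feasible st → Placed (level st) (survivorAfter (phase st))
  placed-after ⟨ x , ς , at₀ stay , p ⟩    f = placed₀ b₀ (feasible-level f)
  placed-after ⟨ x , ς , at₀ (run _) , p ⟩ f = placed₀ b₄ (feasible-level f)
  placed-after ⟨ x , ς , at₄ _ , p ⟩       f = placed₀ b₃ (feasible-level f)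
  placed-after ⟨ x , ς , at₃ _ , p ⟩       f = placed₀ b₂ (feasible-level f)
  placed-after ⟨ x , ς , at₂ loop , p ⟩    f = placed₀ b₁ (feasible-level f)
  placed-after ⟨ x , ς , at₂ exit , p ⟩    f = placed₊₁ (feasible-exit f)
  placed-after ⟨ x , ς , at₁ , p ⟩         f = placed₀ b₀ (feasible-level f)

  placed-position : ∀ st → Feasible st → Placed (level st) (o₀ , corner (phase st))
  placed-position st f = placed₀ (corner (phase st)) (feasible-level f)

  route-step : ∀ st → Feasible st → position (next st) ≡ position st ⊎ Adj (position st) (position (next st))
  route-step ⟨ x , ς , at₀ stay , p ⟩ _ = inj₁ refl
  route-step st@(⟨ x , ς , at₀ (run _) , p ⟩) f = inj₂ (adjᴸ⇒Adj (placed-position st f) (placed-after st f) tt)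
  route-step st@(⟨ x , ς , at₄ _ , p ⟩)       f = inj₂ (adjᴸ⇒Adj (placed-position st f) (placed-after st f) tt)
  route-step st@(⟨ x , ς , at₃ _ , p ⟩)       f = inj₂ (adjᴸ⇒Adj (placed-position st f) (placed-after st f) tt)
  route-step st@(⟨ x , ς , at₂ loop , p ⟩)    f = inj₂ (adjᴸ⇒Adj (placed-position st f) (placed-after st f) tt)
  route-step st@(⟨ x , ς , at₂ exit , p ⟩)    f = inj₂ (adjᴸ⇒Adj (placed-position st f) (placed-after st f) tt)
  route-step st@(⟨ x , ς , at₁ , p ⟩)         f = inj₂ (adjᴸ⇒Adj (placed-position st f) (placed-after st f) tt)

  -- A lagging zombie with meeting time τ is at distance τ + 2 − now from b₀ of the survivor's copy;
  -- it reaches b₂ of the previous copy exactly when the survivor starts a move from b₀ at clock τ.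
  Lagging : State → ℕ → V → Set
  Lagging st τ z = ∃ λ e → Behind (level st) z × Dist Adj z (entry (level st)) e × e + now st ≡ 2 + τ × Upcoming st τ

  Tight : State → V → Set
  Tight st z = ∃ λ y → Placed (level st) y × z ≡ place (level st) y × T (tight (phase st) y)

  Chasing : State → ℕ → V → Set
  Chasing st τ z = Lagging st τ z ⊎ Tight st z

  Safe : State → ℕ → V → Set
  Safe st τ z = z ≢ position st × z ≢ position (next st) × Chasing (next st) τ z

  tight-move : ∀ {K ph y z' d d'} → K < n → Placed K y → T (tight ph y) → Adj (place K y) z' →
               Dist Adj (place K y) (place K (o₀ , corner ph)) d → Dist Adj z' (place K (o₀ , corner ph)) d' → d' < d →
               z' ≢ place K (o₀ , corner ph) ×
               ∃ λ y' → Placed K y' × z' ≡ place K y' × T (not (y' ==ᴸ survivorAfter ph)) × T (tightAfter ph y')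
  tight-move {K} {ph} {y@(o , u)} K<n on tight-y adj Dz Dz' d'<d =
    let two , _                       = T-∧⁻ (T-⇒ᵇ (tightStepOk-holds ph y y) tight-y)
        z'≢s , y' , on' , z'≡y' , path = two-away-step {K} {corner ph} {o} {u} K<n on two adj Dz Dz' d'<d
        fresh , tight-y'              = T-∧⁻ (T-⇒ᵇ (proj₂ (T-∧⁻ (T-⇒ᵇ (tightStepOk-holds ph y y') tight-y))) path)
    in z'≢s , y' , on' , z'≡y' , fresh , tight-y'

  advance-tight : ∀ st {y} → Feasible st → Placed (level st) y → T (tightAfter (phase st) y) →
                  Tight (next st) (place (level st) y)
  advance-tight ⟨ x , ς , at₀ stay , p ⟩ _ _ ()
  advance-tight ⟨ x , ς , at₀ (run _) , p ⟩ _ on h = _ , on , refl , h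
  advance-tight ⟨ x , ς , at₄ _ , p ⟩       _ on h = _ , on , refl , h
  advance-tight ⟨ x , ς , at₃ _ , p ⟩       _ on h = _ , on , refl , h
  advance-tight ⟨ x , ς , at₂ loop , p ⟩    _ on h = _ , on , refl , h
  advance-tight ⟨ x , ς , at₂ exit , p ⟩ {o₀ , w} f (placed on) h =
    (o₋₁ , w) , placed on , refl , tight-at₀ (head-moving (staysFirst-run (Feasible.ordered f))) h
  advance-tight ⟨ x , ς , at₂ exit , p ⟩ {o₊₁ , w} f (placed on) h =
    (o₀ , w) , placed on , refl , tight-at₀ (head-moving (staysFirst-run (Feasible.ordered f))) h
  advance-tight ⟨ x , ς , at₁ , p ⟩ f on h =
    _ , on , refl , tight-at₀ (head-moving (staysFirst-run (Feasible.ordered f))) h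

  tight-step : ∀ st τ {z z' d d'} → Feasible st → Tight st z → Adj z z' →
               Dist Adj z (position st) d → Dist Adj z' (position st) d' → d' < d → Safe st τ z'
  tight-step st τ f (y , on , refl , tight-y) adj Dz Dz' d'<d =
    let z'≢s , y' , on' , z'≡y' , fresh , tight-y' = tight-move (feasible-level f) on tight-y adj Dz Dz' d'<d
        y'≢after : place (level st) y' ≢ position (next st)
        y'≢after eq = T-not⇒¬T _ fresh
          (fromWitness {a? = ≡-dec _≟_ _≟ᵀ_ y' (survivorAfter (phase st))}
            (place-injective on' (placed-after st f) (trans eq (position-next st))))
    in z'≢s , (λ eq → y'≢after (trans (sym z'≡y') eq)) ,
       inj₂ (subst (Tight (next st)) (sym z'≡y') (advance-tight st f on' tight-y'))

  position-ahead : ∀ st → Feasible st → ¬ Behind (level st) (position st)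
  position-ahead st f = not-behind (placed-position st f) ≤-refl

  next-position-ahead : ∀ st → Feasible st → ¬ Behind (level st) (position (next st))
  next-position-ahead st f rewrite position-next st = not-behind (placed-after st f) (after-ahead (phase st))
    where
    after-ahead : ∀ ph → 2 ≤ toℕ (proj₁ (survivorAfter ph))
    after-ahead (at₀ stay)    = ≤-refl
    after-ahead (at₀ (run _)) = ≤-refl
    after-ahead (at₄ _)       = ≤-refl
    after-ahead (at₃ _)       = ≤-refl
    after-ahead (at₂ loop)    = ≤-refl
    after-ahead (at₂ exit)    = n≤1+n 2
    after-ahead at₁           = ≤-refl

  tick : ∀ {e' k τ} → 2 + e' + k ≡ 2 + τ → suc e' + suc k ≡ 2 + τ
  tick {e'} {k} eq = trans (cong suc (+-suc e' k)) eq

  exit-tick : ∀ {e' ς τ} → 2 + e' + (3 + ς) ≡ 2 + τ → suc e' + 3 + suc ς ≡ 2 + τ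
  exit-tick {e'} {ς} eq = trans (cong suc (trans (+-assoc e' 3 (suc ς)) (+-suc e' (3 + ς)))) eq

  lag-behind : ∀ st τ {z' e'} → Feasible st → Behind (level st) z' → Dist Adj z' (entry (level st)) (suc e') →
               2 + e' + now st ≡ 2 + τ → Upcoming st τ → Chasing (next st) τ z'
  lag-behind ⟨ x , ς , at₀ stay , p ⟩ τ _ _ _ _ (starts ())
  lag-behind ⟨ x , ς , at₀ stay , p ⟩ τ _ z'-in Dz' eq (skips r) = inj₁ (_ , z'-in , Dz' , tick eq , r)
  lag-behind ⟨ x , ς , at₀ (run _) , p ⟩ τ _ z'-in Dz' eq (skips r) = inj₁ (_ , z'-in , Dz' , tick eq , r)
  lag-behind st@(⟨ x , ς , at₀ (run _) , p ⟩) .ς f z'-in Dz' eq (starts _)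
    with +-cancelʳ-≡ ς _ 0 (suc-injective (suc-injective eq))
  ... | refl with caught-up (feasible-level f) z'-in Dz'
  ... | refl = inj₂ (advance-tight st f (placed-preEntry (feasible-level f)) tt)
  lag-behind ⟨ x , ς , at₄ _ , p ⟩    τ _ z'-in Dz' eq up = inj₁ (_ , z'-in , Dz' , tick eq , up)
  lag-behind ⟨ x , ς , at₃ _ , p ⟩    τ _ z'-in Dz' eq up = inj₁ (_ , z'-in , Dz' , tick eq , up)
  lag-behind ⟨ x , ς , at₂ loop , p ⟩ τ _ z'-in Dz' eq up = inj₁ (_ , z'-in , Dz' , tick eq , up)
  lag-behind ⟨ x , ς , at₁ , p ⟩      τ _ z'-in Dz' eq up = inj₁ (_ , z'-in , Dz' , tick eq , up)
  lag-behind ⟨ x , ς , at₂ exit , p ⟩ τ f z'-in Dz' eq up with entry-distance-suc (feasible-exit f) (inj₁ z'-in) Dz'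
  ... | Dz'' , z'-in′ = inj₁ (_ , z'-in′ , Dz'' , exit-tick eq , up)

  overtaken : ∀ {k d ς τ} → k ≤ d → 1 + (k + ς) ≡ 2 + τ → d + ς ≤ τ → ⊥
  overtaken {ς = ς} k≤d eq d+ς≤τ = <-irrefl (suc-injective eq) (s≤s (≤-trans (+-monoˡ-≤ ς k≤d) d+ς≤τ))

  -- Stepping onto b₀ forces now = τ + 1, which the meeting time rules out except in the last two phases of an exit.
  lag-at-entry : ∀ st τ → Feasible st → 1 + now st ≡ 2 + τ → Upcoming st τ → Safe st τ (entry (level st))
  lag-at-entry ⟨ x , ς , at₀ _ , p ⟩      τ _ eq up = ⊥-elim (overtaken {0} {0} z≤n eq (meets-≤ up))
  lag-at-entry ⟨ x , ς , at₄ loop , p ⟩   τ _ eq up = ⊥-elim (overtaken {1} {5} (s≤s z≤n) eq (meets-≤ up))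
  lag-at-entry ⟨ x , ς , at₄ exit , p ⟩   τ _ eq up = ⊥-elim (overtaken {1} {1} ≤-refl eq (meets-≤ up))
  lag-at-entry ⟨ x , ς , at₃ loop , p ⟩   τ _ eq up = ⊥-elim (overtaken {2} {5} (s≤s (s≤s z≤n)) eq (meets-≤ up))
  lag-at-entry ⟨ x , ς , at₂ loop , p ⟩   τ _ eq up = ⊥-elim (overtaken {3} {5} (s≤s (s≤s (s≤s z≤n))) eq (meets-≤ up))
  lag-at-entry ⟨ x , ς , at₁ , p ⟩        τ _ eq up = ⊥-elim (overtaken {4} {5} (n≤1+n 4) eq (meets-≤ up))
  lag-at-entry st@(⟨ x , ς , at₃ exit , p ⟩) τ f eq up =
    local-≢ (at b₀) (at b₃) (λ ()) , local-≢ (at b₀) (at b₂) (λ ()) , inj₂ (advance-tight st f (at b₀) tt)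
    where
    at : ∀ w → Placed x (o₀ , w)
    at w = placed₀ w (feasible-level f)
  lag-at-entry ⟨ x , ς , at₂ exit , p ⟩ τ f eq up with entry-distance-suc (feasible-exit f) (inj₂ refl) (here , λ _ _ → z≤n)
  ... | D , entry-in =
    local-≢ (at b₀) (at b₂) (λ ()) , local-≢ (at b₀) (placed₊₁ (feasible-exit f)) (λ ()) , inj₁ (_ , entry-in , D , eq , up)
    where
    at : ∀ w → Placed x (o₀ , w)
    at w = placed₀ w (feasible-level f)

  lag-step : ∀ st τ {z z' d d'} → Feasible st → Lagging st τ z → Adj z z' →
             Dist Adj z (position st) d → Dist Adj z' (position st) d' → d' < d → Safe st τ z'
  lag-step st τ f (e , z-in , De , eq , up) adj Dz Dz' d'<d
    with GateAt.step-towards (feasible-level f) z-in (position-ahead st f) De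
           (proj₂ (entry-to-corner (feasible-level f) (cornerIndex (phase st)))) adj Dz Dz' d'<d
  ... | inj₁ (e' , refl , z'-in , Dz'') =
    behind-≢ z'-in (position-ahead st f) , behind-≢ z'-in (next-position-ahead st f) , lag-behind st τ f z'-in Dz'' eq up
  ... | inj₂ (refl , refl) = lag-at-entry st τ f eq up

  chase-step : ∀ st τ {z z' d d'} → Feasible st → Chasing st τ z → Adj z z' →
               Dist Adj z (position st) d → Dist Adj z' (position st) d' → d' < d → Safe st τ z'
  chase-step st τ f (inj₁ lagging) = lag-step st τ f lagging
  chase-step st τ f (inj₂ tight-z) = tight-step st τ f tight-z

  open Game Adj

  follow-route : ∀ {m} → State → Strategy m
  follow-route st₀ h _ = position (route st₀ (length h))

  survivor-wins : ∀ {m} st (τs : Vec ℕ m) (zs : Vec V m) → Feasible st →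
                  (∀ i → Chasing st (lookup τs i) (lookup zs i)) → SurvivorWins (position st) zs
  survivor-wins {m} st₀ τs zs₀ f₀ chasing₀ = follow-route st₀ , winning
    where
    Invariant : List (V × Vec V m) → V → Vec V m → Set
    Invariant h s zs = s ≡ position (route st₀ (length h)) × Feasible (route st₀ (length h)) ×
                       (∀ i → Chasing (route st₀ (length h)) (lookup τs i) (lookup zs i))
    safe : ∀ {h s} zs zs' → Invariant h s zs → ZMove s zs zs' →
           ∀ i → Safe (route st₀ (length h)) (lookup τs i) (lookup zs' i)
    safe {h} _ _ (refl , f , chasing) zmove i with zmove i
    ... | adj , _ , _ , Dz , Dz' , d'<d = chase-step (route st₀ (length h)) (lookup τs i) f (chasing i) adj Dz Dz' d'<d
    invariant : ∀ {h s zs} → Reach (follow-route st₀) (position st₀) zs₀ h s zs → Invariant h s zs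
    invariant start = refl , f₀ , chasing₀
    invariant (round {h} {_} {zs} {zs'} r zmove) with invariant r
    ... | inv@(_ , f , _) = refl , feasible-next (route st₀ (length h)) f , λ i → proj₂ (proj₂ (safe {h} zs zs' inv zmove i))
    winning : Winning (follow-route st₀) (position st₀) zs₀
    winning h s zs r zs' zmove with invariant r
    ... | inv@(refl , f , _) =
      (λ (i , caught) → proj₁ (safe {h} zs zs' inv zmove i) caught) ,
      route-step (route st₀ (length h)) f ,
      (λ (i , caught) → proj₁ (proj₂ (safe {h} zs zs' inv zmove i)) caught)

mainTheorem3 : (n : ℕ) (H : FinGraph) → FinGraph.Connected H →
    (v : Fin (FinGraph.k H)) →
    (m : ℕ) (zs : Vec (Fin (FinGraph.k H)) m) (ds : Vec ℕ m) →
    (∀ i → Dist (GAdj n H v) (arm (b0 0)) (hv (lookup zs i)) (lookup ds i)) →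
    (∀ i j → i ≤ᶠ j → lookup ds i ≤ lookup ds j) →
    gapSum ds + 1 ≤ n →
    Game.SurvivorWins (GAdj n H v) (arm (b0 0)) (map (hv {n} {H} {v}) zs)
-- The route never enters H.
mainTheorem3 n H _ v m zs ds dist sorted fuel =
  subst (λ s → SurvivorWins s (map hv zs)) (cong arm (vertexAt-b0 0))
    (survivor-wins initial ds (map hv zs) feasible₀ chasing₀)
  where
  open Survival n H v
  open Game Adj
  initial : State
  initial = visit 0 2 (survivorPlan ds)
  gapSum<n : gapSum ds < n
  gapSum<n = subst (_≤ n) (+-comm (gapSum ds) 1) fuel
  feasible₀ : Feasible initial
  feasible₀ = feasible (subst (_< n) (sym (trans (exits-uncons (survivorPlan ds)) (exits-survivorPlan ds))) gapSum<n)
                       (staysFirst-uncons (staysFirst-plan ds))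
  dist₀ : ∀ i → Dist Adj (hv (lookup zs i)) (entry 0) (lookup ds i)
  dist₀ i = subst (λ s → Dist Adj (hv (lookup zs i)) s (lookup ds i)) (cong arm (sym (vertexAt-b0 0))) (Dist-sym (dist i))
  chasing₀ : ∀ i → Chasing initial (lookup ds i) (lookup (map hv zs) i)
  chasing₀ i rewrite lookup-map i (hv {n} {H} {v}) zs =
    inj₁ (lookup ds i , behind (s≤s z≤n) , dist₀ i , +-comm (lookup ds i) 2 ,
          meets-survivorPlan ds sorted (λ j → entry₀-far-from-H (≤-<-trans z≤n gapSum<n) (proj₁ (dist₀ j))) i)
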